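{- For any given root (non-recursive) call of $\texttt{BA-parent}$ in the on-the-fly BA generator, with high probability that call takes $O(\log^2 n)$ time.
   Context: Nodes are $1,\dots,n$. The pointers tree: each node $i\in[2,n]$ independently has a pointer $u(i)$ uniform on $[1,i-1]$ and a flag $\mathrm{type}(i)$ uniform on $\{\mathtt{dir},\mathtt{rec}\}$. The procedure $\texttt{BA-parent}(j)$ calls $\texttt{parent}(j)$ to obtain $(i,\mathrm{flag})$; if the flag is $\mathtt{dir}$ it returns $i$, otherwise it returns $\texttt{BA-parent}(i)$ (a recursive call). The procedure $\texttt{parent}(j)$ of the on-the-fly pointers-tree generator returns $(u(j),\mathrm{type}(j))$, and if $u(j)$ is not yet set it first samples $u(j)$ uniformly from $[1,j-1]$ and $\mathrm{type}(j)$ uniformly from $\{\mathtt{dir},\mathtt{rec}\}$ and inserts $j$ into a balanced search tree of known children of $u(j)$; a call to $\texttt{parent}$ takes $O(\log n)$ time (arrays are implemented by balanced search trees with $O(\log n)$ access time). "With high probability" means with probability at least $1-n^{ -c}$ for some constant $c>0$. -}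

module Defs where

open import Data.Nat using (ℕ; zero; suc; _+_; _*_; _∸_; _^_; _≤_; _<_)
open import Data.Nat.Logarithm using (⌊log₂_⌋)
open import Data.Bool using (Bool; true; false; if_then_else_)
open import Data.List using (List; []; _∷_; _++_; map; concatMap; length; filter; allFin)
open import Data.Fin using (Fin; toℕ)
open import Data.Product using (_×_; _,_)
open import Relation.Nullary.Decidable using (¬?)
open import Data.Nat using (_≤?_; _≟_)
open import Relation.Nullary using (yes; no)

Flag : Set
Flag = Bool

dir rec : Flag
dir = true
rec = false

-- A pointers tree on nodes 1..n, stored as the list of choices
-- (u(i), type(i)) for i = 2..n.  Realization on nodes 1..(k+1):
-- PT k holds the choices of nodes 2..k+1, node i = m+2 has u(i) ∈ Fin (m+1),
-- i.e. u(i) = toℕ + 1 ∈ [1, i-1].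
data PT : ℕ → Set where
  []  : PT 0
  _▷_ : ∀ {m} → PT m → Fin (suc m) × Flag → PT (suc m)

-- All pointers trees on nodes 1..(k+1); each appears once, so the uniform
-- measure on this list is the product of the uniform choices in the model.
allPT : (k : ℕ) → List (PT k)
allPT zero    = [] ∷ []
allPT (suc m) = concatMap (λ t → concatMap (λ u → map (λ b → t ▷ (u , b)) (true ∷ false ∷ [])) (allFin (suc m))) (allPT m)

-- parent(j) for node j (as a natural number): returns (u(j), type(j)).
-- Nodes outside [2, k+1] return (0, dir) (never used in the statement).
parent : ∀ {k} → PT k → ℕ → ℕ × Flag
parent [] j = 0 , dir
parent {suc m} (t ▷ (u , b)) j with j ≟ (m + 2)
... | yes _ = suc (toℕ u) , b
... | no  _ = parent t j

-- Number of parent calls made by BA-parent(j), run with a fuel bound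
-- (fuel = j suffices, since pointers strictly decrease).
baCalls : ∀ {k} → PT k → (fuel j : ℕ) → ℕ
baCalls t zero       j = 0
baCalls t (suc fuel) j with parent t j
... | i , true  = 1
... | i , false = suc (baCalls t fuel i)

-- Running time of the root call BA-parent(j) in the cost model where each
-- call of parent costs log n (taken as ⌊log₂ n⌋ + 1) time units.
logCost : ℕ → ℕ
logCost n = suc ⌊log₂ n ⌋

baTime : (n : ℕ) → PT (n ∸ 1) → ℕ → ℕ
baTime n t j = baCalls t j j * logCost n

badCount : (n j B : ℕ) → ℕ
badCount n j B = length (filter (λ t → ¬? (baTime n t j ≤? B)) (allPT (n ∸ 1)))

totalCount : ℕ → ℕ
totalCount n = length (allPT (n ∸ 1))

-- Pointers strictly decrease, so every parent call of BA-parent(j) reads the flag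
-- of a node it has not looked at before; that flag is dir with probability 1/2
-- independently of the walk so far.  Hence the walk makes more than m calls
-- with probability at most 2^(-m).  Each call costs log n, so the running time
-- exceeds log² n only if there are more than L = ⌊log₂ n⌋ + 1 calls, which
-- happens with probability at most 2^(-L) < 1/n.  In counting form, the tail
-- bound is proved by induction on the number of nodes, splitting on whether
-- the walk starts at the newest node.
module Submission where

open import Defs
open import Data.Nat using (ℕ; suc; _*_; _^_; _≤_)
open import Data.Nat.Logarithm using (⌊log₂_⌋)
open import Data.Product using (∃-syntax; _×_)

open import Data.Nat using (zero; _+_; _∸_; _<_; _<?_; _≟_; z≤n; s≤s; s≤s⁻¹; s<s; s<s⁻¹)
open import Data.Nat.Properties
open import Data.Nat.Logarithm using (⌊log₂⌋-mono-≤; ⌊log₂[2^n]⌋≡n)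
open import Data.List using (List; []; _∷_; _++_; map; concatMap; length; filter; allFin)
open import Data.List.Properties using (length-tabulate)
open import Data.Fin using (Fin; toℕ)
open import Data.Fin.Properties using (toℕ<n)
open import Data.Product using (_,_; proj₁)
open import Data.Bool using (true; false)
open import Data.Empty using (⊥-elim)
open import Function using (id)
open import Relation.Nullary using (Dec; yes; no; ¬_)
open import Relation.Binary.PropositionalEquality
open import Algebra.Properties.CommutativeSemigroup +-commutativeSemigroup using (interchange)
open import Algebra.Properties.CommutativeSemigroup *-commutativeSemigroup using (x∙yz≈y∙xz)

private
  variable
    A B : Set
    P Q : Set
    k : ℕ

∑ : List A → (A → ℕ) → ℕ
∑ []       h = 0
∑ (x ∷ xs) h = h x + ∑ xs h

infix 5 ∑
syntax ∑ xs (λ x → e) = ∑[ x ← xs ] e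

∑-++ : (xs ys : List A) (h : A → ℕ) → ∑ (xs ++ ys) h ≡ ∑ xs h + ∑ ys h
∑-++ []       ys h = refl
∑-++ (x ∷ xs) ys h = trans (cong (h x +_) (∑-++ xs ys h)) (sym (+-assoc (h x) _ _))

∑-map : (g : A → B) (xs : List A) (h : B → ℕ) → ∑ (map g xs) h ≡ ∑[ x ← xs ] h (g x)
∑-map g []       h = refl
∑-map g (x ∷ xs) h = cong (h (g x) +_) (∑-map g xs h)

∑-concatMap : (g : A → List B) (xs : List A) (h : B → ℕ) →
              ∑ (concatMap g xs) h ≡ ∑[ x ← xs ] ∑ (g x) h
∑-concatMap g []       h = refl
∑-concatMap g (x ∷ xs) h =
  trans (∑-++ (g x) (concatMap g xs) h) (cong (∑ (g x) h +_) (∑-concatMap g xs h))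

∑-cong : (xs : List A) {h h′ : A → ℕ} → (∀ x → h x ≡ h′ x) → ∑ xs h ≡ ∑ xs h′
∑-cong []       _  = refl
∑-cong (x ∷ xs) eq = cong₂ _+_ (eq x) (∑-cong xs eq)

∑-mono-≤ : (xs : List A) {h h′ : A → ℕ} → (∀ x → h x ≤ h′ x) → ∑ xs h ≤ ∑ xs h′
∑-mono-≤ []       _  = z≤n
∑-mono-≤ (x ∷ xs) le = +-mono-≤ (le x) (∑-mono-≤ xs le)

∑-const : (xs : List A) (c : ℕ) → ∑[ x ← xs ] c ≡ length xs * c
∑-const []       c = refl
∑-const (x ∷ xs) c = cong (c +_) (∑-const xs c)

length≡∑1 : (xs : List A) → length xs ≡ ∑[ x ← xs ] 1
length≡∑1 xs = sym (trans (∑-const xs 1) (*-identityʳ (length xs)))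

∑-allFin-const : (n c : ℕ) → ∑[ u ← allFin n ] c ≡ n * c
∑-allFin-const n c = trans (∑-const (allFin n) c) (cong (_* c) (length-tabulate {n = n} id))

*-distribˡ-∑ : (c : ℕ) (xs : List A) (h : A → ℕ) → c * ∑ xs h ≡ ∑[ x ← xs ] c * h x
*-distribˡ-∑ c []       h = *-zeroʳ c
*-distribˡ-∑ c (x ∷ xs) h =
  trans (*-distribˡ-+ c (h x) (∑ xs h)) (cong (c * h x +_) (*-distribˡ-∑ c xs h))

∑-+ : (xs : List A) (h g : A → ℕ) → ∑[ x ← xs ] (h x + g x) ≡ ∑ xs h + ∑ xs g
∑-+ []       h g = refl
∑-+ (x ∷ xs) h g =
  trans (cong (h x + g x +_) (∑-+ xs h g)) (interchange (h x) (g x) (∑ xs h) (∑ xs g))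

∑-comm : (xs : List A) (ys : List B) (h : A → B → ℕ) →
         ∑[ x ← xs ] ∑[ y ← ys ] h x y ≡ ∑[ y ← ys ] ∑[ x ← xs ] h x y
∑-comm []       ys h = sym (trans (∑-const ys 0) (*-zeroʳ (length ys)))
∑-comm (x ∷ xs) ys h =
  trans (cong ((∑[ y ← ys ] h x y) +_) (∑-comm xs ys h)) (sym (∑-+ ys (h x) _))

𝟙 : Dec P → ℕ
𝟙 (yes _) = 1
𝟙 (no _)  = 0

𝟙≤1 : (P? : Dec P) → 𝟙 P? ≤ 1
𝟙≤1 (yes _) = ≤-refl
𝟙≤1 (no _)  = z≤n

𝟙-no : (P? : Dec P) → ¬ P → 𝟙 P? ≡ 0
𝟙-no (yes p) ¬p = ⊥-elim (¬p p)
𝟙-no (no _)  _  = refl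

𝟙-mono : (P? : Dec P) (Q? : Dec Q) → (P → Q) → 𝟙 P? ≤ 𝟙 Q?
𝟙-mono (yes _) (yes _) _   = ≤-refl
𝟙-mono (yes p) (no ¬q) P⇒Q = ⊥-elim (¬q (P⇒Q p))
𝟙-mono (no _)  _       _   = z≤n

𝟙-cong : (P? : Dec P) (Q? : Dec Q) → (P → Q) → (Q → P) → 𝟙 P? ≡ 𝟙 Q?
𝟙-cong P? Q? P⇒Q Q⇒P = ≤-antisym (𝟙-mono P? Q? P⇒Q) (𝟙-mono Q? P? Q⇒P)

length-filter≡∑𝟙 : {R : A → Set} (R? : (x : A) → Dec (R x)) (xs : List A) →
                   length (filter R? xs) ≡ ∑[ x ← xs ] 𝟙 (R? x)
length-filter≡∑𝟙 R? []       = refl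
length-filter≡∑𝟙 R? (x ∷ xs) with R? x
... | yes _ = cong suc (length-filter≡∑𝟙 R? xs)
... | no _  = length-filter≡∑𝟙 R? xs

-- In t ▷ x : PT (suc k) the newest node is k + 2; the nodes of t are at most k + 1.
newest-fresh : ∀ {i} → i ≤ suc k → i ≢ k + 2
newest-fresh {k} i≤1+k refl = m+1+n≰m k (s≤s⁻¹ (subst (_≤ suc k) (+-suc k 1) i≤1+k))

parent-≤ : (t : PT k) (j : ℕ) → proj₁ (parent t j) ≤ k
parent-≤ [] j = z≤n
parent-≤ {suc k} (t ▷ (u , b)) j with j ≟ (k + 2)
... | yes _ = toℕ<n u
... | no _  = m≤n⇒m≤1+n (parent-≤ t j)

parent-▷ : (t : PT k) (x : Fin (suc k) × Flag) (j : ℕ) → j ≢ k + 2 →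
           parent (t ▷ x) j ≡ parent t j
parent-▷ {k} t x j j≢ with j ≟ (k + 2)
... | yes j≡ = ⊥-elim (j≢ j≡)
... | no _   = refl

parent-newest : (t : PT k) (u : Fin (suc k)) (b : Flag) →
                parent (t ▷ (u , b)) (k + 2) ≡ (suc (toℕ u) , b)
parent-newest {k} t u b with (k + 2) ≟ (k + 2)
... | yes _ = refl
... | no ≢  = ⊥-elim (≢ refl)

baCalls-dir : (t : PT k) (f j : ℕ) {i : ℕ} → parent t j ≡ (i , dir) → baCalls t (suc f) j ≡ 1
baCalls-dir t f j eq rewrite eq = refl

baCalls-rec : (t : PT k) (f j : ℕ) {i : ℕ} → parent t j ≡ (i , rec) →
              baCalls t (suc f) j ≡ suc (baCalls t f i)
baCalls-rec t f j eq rewrite eq = refl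

baCalls-▷ : (t : PT k) (x : Fin (suc k) × Flag) (f j : ℕ) → j ≢ k + 2 →
            baCalls (t ▷ x) f j ≡ baCalls t f j
baCalls-▷ t x zero    j j≢ = refl
baCalls-▷ {k} t x (suc f) j j≢ with parent t j in eq
... | i , true  = baCalls-dir (t ▷ x) f j (trans (parent-▷ t x j j≢) eq)
... | i , false =
  trans (baCalls-rec (t ▷ x) f j (trans (parent-▷ t x j j≢) eq))
        (cong suc (baCalls-▷ t x f i (newest-fresh (m≤n⇒m≤1+n i≤k))))
  where
  i≤k : i ≤ k
  i≤k = subst (_≤ k) (cong proj₁ eq) (parent-≤ t j)

baCalls-newest-dir : (t : PT k) (u : Fin (suc k)) (f : ℕ) →
                     baCalls (t ▷ (u , dir)) (suc f) (k + 2) ≡ 1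
baCalls-newest-dir {k} t u f = baCalls-dir (t ▷ (u , dir)) f (k + 2) (parent-newest t u dir)

baCalls-newest-rec : (t : PT k) (u : Fin (suc k)) (f : ℕ) →
                     baCalls (t ▷ (u , rec)) (suc f) (k + 2) ≡ suc (baCalls t f (suc (toℕ u)))
baCalls-newest-rec {k} t u f =
  trans (baCalls-rec (t ▷ (u , rec)) f (k + 2) (parent-newest t u rec))
        (cong suc (baCalls-▷ t (u , rec) f (suc (toℕ u)) (newest-fresh (toℕ<n u))))

∑-allPT-suc : (h : PT (suc k) → ℕ) →
              ∑ (allPT (suc k)) h
                ≡ ∑[ t ← allPT k ] ∑[ u ← allFin (suc k) ] ∑[ b ← dir ∷ rec ∷ [] ] h (t ▷ (u , b))
∑-allPT-suc {k} h =
  trans (∑-concatMap children (allPT k) h) (∑-cong (allPT k) λ t →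
    trans (∑-concatMap (flagged t) (allFin (suc k)) h) (∑-cong (allFin (suc k)) λ u →
      ∑-map (λ b → t ▷ (u , b)) (dir ∷ rec ∷ []) h))
  where
  flagged : PT k → Fin (suc k) → List (PT (suc k))
  flagged t u = map (λ b → t ▷ (u , b)) (dir ∷ rec ∷ [])
  children : PT k → List (PT (suc k))
  children t = concatMap (flagged t) (allFin (suc k))

init : PT (suc k) → PT k
init (t ▷ _) = t

∑-allPT-suc-init : (g : PT k → ℕ) → ∑[ t ← allPT (suc k) ] g (init t) ≡ suc k * (2 * ∑ (allPT k) g)
∑-allPT-suc-init {k} g = begin
  ∑[ t ← allPT (suc k) ] g (init t)               ≡⟨ ∑-allPT-suc (λ t → g (init t)) ⟩
  ∑[ t ← allPT k ] ∑[ u ← allFin (suc k) ] 2 * g t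
    ≡⟨ ∑-cong (allPT k) (λ t → ∑-allFin-const (suc k) (2 * g t)) ⟩
  ∑[ t ← allPT k ] suc k * (2 * g t)               ≡⟨ *-distribˡ-∑ (suc k) (allPT k) (λ t → 2 * g t) ⟨
  suc k * (∑[ t ← allPT k ] 2 * g t)               ≡⟨ cong (suc k *_) (*-distribˡ-∑ 2 (allPT k) g) ⟨
  suc k * (2 * ∑ (allPT k) g)                      ∎
  where open ≡-Reasoning

#trees-suc : (k : ℕ) → length (allPT (suc k)) ≡ suc k * (2 * length (allPT k))
#trees-suc k =
  trans (length≡∑1 (allPT (suc k)))
        (trans (∑-allPT-suc-init {k} (λ _ → 1))
               (cong (λ N → suc k * (2 * N)) (sym (length≡∑1 (allPT k)))))

#longWalks : (k fuel j m : ℕ) → ℕ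
#longWalks k fuel j m = ∑[ t ← allPT k ] 𝟙 (m <? baCalls t fuel j)

#longWalks-older : ∀ f j m → j ≢ k + 2 → #longWalks (suc k) f j m ≡ suc k * (2 * #longWalks k f j m)
#longWalks-older {k} f j m j≢ =
  trans (∑-cong (allPT (suc k)) unchanged) (∑-allPT-suc-init {k} (λ t → 𝟙 (m <? baCalls t f j)))
  where
  unchanged : (t : PT (suc k)) → 𝟙 (m <? baCalls t f j) ≡ 𝟙 (m <? baCalls (init t) f j)
  unchanged (t ▷ x) = cong (λ c → 𝟙 (m <? c)) (baCalls-▷ t x f j j≢)

-- From the newest node the dir half of the trees stops after one call, while the
-- rec half makes one call and continues as a walk in the older tree: this halves the count.
#longWalks-newest : ∀ f m →
  #longWalks (suc k) (suc f) (k + 2) (suc m) ≡ ∑[ u ← allFin (suc k) ] #longWalks k f (suc (toℕ u)) m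
#longWalks-newest {k} f m =
  trans (∑-allPT-suc {k} _) (trans (∑-cong (allPT k) λ t → ∑-cong (allFin (suc k)) (one-more-call t))
        (∑-comm (allPT k) (allFin (suc k)) λ t u → 𝟙 (m <? baCalls t f (suc (toℕ u)))))
  where
  one-more-call : (t : PT k) (u : Fin (suc k)) →
    ∑[ b ← dir ∷ rec ∷ [] ] 𝟙 (suc m <? baCalls (t ▷ (u , b)) (suc f) (k + 2))
      ≡ 𝟙 (m <? baCalls t f (suc (toℕ u)))
  one-more-call t u rewrite baCalls-newest-dir t u f | baCalls-newest-rec t u f =
    trans (cong₂ _+_ (𝟙-no (suc m <? 1) λ { (s≤s ()) }) (+-identityʳ (𝟙 (suc m <? suc c))))
          (𝟙-cong _ _ s<s⁻¹ s<s)
    where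
    c : ℕ
    c = baCalls t f (suc (toℕ u))

longWalks-vanish : ∀ k f j m → ((t : PT k) → baCalls t f j ≤ m) → #longWalks k f j m ≡ 0
longWalks-vanish k f j m short =
  trans (∑-cong (allPT k) λ t → 𝟙-no _ (≤⇒≯ (short t)))
        (trans (∑-const (allPT k) 0) (*-zeroʳ (length (allPT k))))

longWalks-tail : ∀ k f j m → 2 ^ m * #longWalks k f j m ≤ length (allPT k)
longWalks-tail k f j zero = begin
  1 * #longWalks k f j 0      ≡⟨ *-identityˡ _ ⟩
  #longWalks k f j 0          ≤⟨ ∑-mono-≤ (allPT k) (λ t → 𝟙≤1 (0 <? baCalls t f j)) ⟩
  ∑[ t ← allPT k ] 1          ≡⟨ length≡∑1 (allPT k) ⟨
  length (allPT k)            ∎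
  where open ≤-Reasoning
longWalks-tail k zero j (suc m)
  rewrite longWalks-vanish k zero j (suc m) (λ _ → z≤n) | *-zeroʳ (2 ^ suc m) = z≤n
longWalks-tail zero (suc f) j (suc m)
  rewrite longWalks-vanish 0 (suc f) j (suc m) (λ { [] → s≤s z≤n }) | *-zeroʳ (2 ^ suc m) = z≤n
longWalks-tail (suc k) (suc f) j (suc m) with j ≟ k + 2
... | no j≢ = begin
  2 ^ suc m * #longWalks (suc k) (suc f) j (suc m)
    ≡⟨ cong (2 ^ suc m *_) (#longWalks-older (suc f) j (suc m) j≢) ⟩
  2 ^ suc m * (suc k * (2 * W))
    ≡⟨ x∙yz≈y∙xz (2 ^ suc m) (suc k) (2 * W) ⟩
  suc k * (2 ^ suc m * (2 * W))
    ≡⟨ cong (suc k *_) (x∙yz≈y∙xz (2 ^ suc m) 2 W) ⟩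
  suc k * (2 * (2 ^ suc m * W))
    ≤⟨ *-monoʳ-≤ (suc k) (*-monoʳ-≤ 2 (longWalks-tail k (suc f) j (suc m))) ⟩
  suc k * (2 * length (allPT k))
    ≡⟨ #trees-suc k ⟨
  length (allPT (suc k))
    ∎
  where
  open ≤-Reasoning
  W : ℕ
  W = #longWalks k (suc f) j (suc m)
... | yes refl = begin
  2 ^ suc m * #longWalks (suc k) (suc f) (k + 2) (suc m)
    ≡⟨ cong (2 ^ suc m *_) (#longWalks-newest {k} f m) ⟩
  2 ^ suc m * (∑[ u ← allFin (suc k) ] W u)
    ≡⟨ *-distribˡ-∑ (2 ^ suc m) (allFin (suc k)) W ⟩
  ∑[ u ← allFin (suc k) ] 2 ^ suc m * W u
    ≡⟨ ∑-cong (allFin (suc k)) (λ u → *-assoc 2 (2 ^ m) (W u)) ⟩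
  ∑[ u ← allFin (suc k) ] 2 * (2 ^ m * W u)
    ≤⟨ ∑-mono-≤ (allFin (suc k)) (λ u → *-monoʳ-≤ 2 (longWalks-tail k f (suc (toℕ u)) m)) ⟩
  ∑[ u ← allFin (suc k) ] 2 * length (allPT k)
    ≡⟨ ∑-allFin-const (suc k) _ ⟩
  suc k * (2 * length (allPT k))
    ≡⟨ #trees-suc k ⟨
  length (allPT (suc k))
    ∎
  where
  open ≤-Reasoning
  W : Fin (suc k) → ℕ
  W u = #longWalks k f (suc (toℕ u)) m

n<2^suc⌊log₂n⌋ : (n : ℕ) → n < 2 ^ suc ⌊log₂ n ⌋
n<2^suc⌊log₂n⌋ n = ≰⇒> λ 2^L≤n → 1+n≰n (begin
  suc ⌊log₂ n ⌋               ≡⟨ ⌊log₂[2^n]⌋≡n (suc ⌊log₂ n ⌋) ⟨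
  ⌊log₂ 2 ^ suc ⌊log₂ n ⌋ ⌋   ≤⟨ ⌊log₂⌋-mono-≤ 2^L≤n ⟩
  ⌊log₂ n ⌋                   ∎)
  where open ≤-Reasoning

slow⇒long : (L c : ℕ) → ¬ (c * L ≤ 1 * (L * L)) → L < c
slow⇒long L c slow =
  ≰⇒> λ c≤L → slow (≤-trans (*-monoˡ-≤ L c≤L) (≤-reflexive (sym (*-identityˡ (L * L)))))

badCount-tail : (n j : ℕ) → badCount n j (1 * (suc ⌊log₂ n ⌋ * suc ⌊log₂ n ⌋)) * n ≤ totalCount n
badCount-tail n j = begin
  bad * n                           ≤⟨ *-monoʳ-≤ bad (<⇒≤ (n<2^suc⌊log₂n⌋ n)) ⟩
  bad * 2 ^ L                       ≡⟨ *-comm bad (2 ^ L) ⟩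
  2 ^ L * bad                       ≤⟨ *-monoʳ-≤ (2 ^ L) bad≤long ⟩
  2 ^ L * #longWalks (n ∸ 1) j j L  ≤⟨ longWalks-tail (n ∸ 1) j j L ⟩
  totalCount n                      ∎
  where
  open ≤-Reasoning
  L : ℕ
  L = suc ⌊log₂ n ⌋
  bad : ℕ
  bad = badCount n j (1 * (L * L))
  bad≤long : bad ≤ #longWalks (n ∸ 1) j j L
  bad≤long = ≤-trans (≤-reflexive (length-filter≡∑𝟙 _ (allPT (n ∸ 1))))
    (∑-mono-≤ (allPT (n ∸ 1)) λ t → 𝟙-mono _ (L <? baCalls t j j) (slow⇒long L (baCalls t j j)))

lemma13 : ∃[ C ] ∃[ p ] ∃[ q ] ∃[ n₀ ]
    ( 1 ≤ p × 1 ≤ q ×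
      ( (n j : ℕ) → n₀ ≤ n → 2 ≤ j → j ≤ n →
        badCount n j (C * (suc ⌊log₂ n ⌋ * suc ⌊log₂ n ⌋)) ^ q * n ^ p
          ≤ totalCount n ^ q ) )
-- The tail bound holds for every j.
lemma13 = 1 , 1 , 1 , 0 , ≤-refl , ≤-refl , λ n j _ _ _ →
  let bad = badCount n j (1 * (suc ⌊log₂ n ⌋ * suc ⌊log₂ n ⌋)) in
  subst₂ _≤_ (sym (cong₂ _*_ (*-identityʳ bad) (*-identityʳ n))) (sym (*-identityʳ (totalCount n)))
    (badCount-tail n j)
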